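{- Let $\tau_0=a_0+b_0i\in\mathcal{F}$ be a quadratic irrationality. Define $\tau_k=a_k+b_ki$ for $k\ge1$ recursively by $a_k=\frac12$, $b_k=\frac{a_{k-1}^2+b_{k-1}^2-a_{k-1}}{2b_{k-1}}$, and let $n$ be the least positive integer with $|\tau_n|\le 1$ (so that $\tau_1,\dots,\tau_n$ is the deep hole sequence of $\tau_0$, with $\Lambda_{\tau_k}=H(\Lambda_{\tau_{k-1}})$). For each $0\le k\le n$ let $E_{\tau_k}=\mathbb{C}/\Lambda_{\tau_k}$ be the corresponding CM elliptic curve. Then all the elliptic curves $E_{\tau_0},\dots,E_{\tau_n}$ are isogenous. Furthermore, for any $0\le k\le n-1$ there exists an isogeny between $E_{\tau_k}$ and $E_{\tau_{k+1}}$ of degree $$\delta_k\le\frac{12\sqrt3\, b_{k+1}\, d_k^4\,(a_k^2+b_k^2)^2}{b_k},$$ where $d_k=\min\{d\in\mathbb{Z}_{>0}: da_k\in\mathbb{Z},\ d^2b_k^2\in\mathbb{Z}\}$.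
   Context: $\mathcal{F}=\{\tau=a+bi\in\mathbb{C}: b\ge0,\ 0\le a\le 1/2,\ |\tau|\ge 1\}$. For $\tau=a+bi$, $\Lambda_\tau=\operatorname{span}_{\mathbb{Z}}\{1,\tau\}\subset\mathbb{C}$, identified with $\begin{pmatrix}1&a\\0&b\end{pmatrix}\mathbb{Z}^2\subset\mathbb{R}^2$. For a lattice $L\subset\mathbb{R}^2$ with minimal basis vectors $\boldsymbol{x}_1,\boldsymbol{x}_2$ ($\|\boldsymbol{x}_1\|\le\|\boldsymbol{x}_2\|$ the successive minima, angle between them in $[\pi/3,\pi/2]$), the fundamental deep hole $\boldsymbol{z}$ is the unique point of maximal distance from $L$ lying in the triangle with vertices $\boldsymbol{0},\boldsymbol{x}_1,\boldsymbol{x}_2$, and $H(L)=\operatorname{span}_{\mathbb{Z}}\{\boldsymbol{x}_1,\boldsymbol{z}\}$. An isogeny $\mathbb{C}/\Lambda\to\mathbb{C}/\Lambda'$ is a map $z\mapsto\beta z$ with $\beta\in\mathbb{C}^*$, $\beta\Lambda\subseteq\Lambda'$; its degree is $[\Lambda':\beta\Lambda]$. -}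

module Defs where

open import Data.Nat using (ℕ; zero; suc)
open import Data.Integer as ℤ using (ℤ)
open import Data.Rational
open import Data.Rational.Properties using (_≟_)
open import Data.Product using (_×_; _,_; proj₁; proj₂; Σ; ∃; ∃-syntax)
open import Relation.Nullary using (yes; no; ¬_)
open import Relation.Binary.PropositionalEquality using (_≡_; _≢_)

-- Convention: τ₀ = a₀ + b₀ i is a quadratic irrationality in F,
-- hence a₀ ∈ ℚ and c := b₀² ∈ ℚ with c > 0.  All τ_k lie in K = ℚ(√c · i).
-- An element of K is represented as a pair (p , q) meaning  p + q·(√c·i).
K : Set
K = ℚ × ℚ

ℤ→ℚ : ℤ → ℚ
ℤ→ℚ z = z / 1

-- multiplication in K = ℚ(√-c)  (since (√c·i)² = -c)
mulK : (c : ℚ) → K → K → K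
mulK c (p , q) (p' , q') = (p * p' - c * (q * q') , p * q' + q * p')

-- total division on ℚ (returns 0 on division by 0; never used at 0 for k ≤ n)
divℚ : ℚ → ℚ → ℚ
divℚ x y with y ≟ 0ℚ
... | yes _ = 0ℚ
... | no y≢0 = _÷_ x y {{≢-nonZero y≢0}}

-- The deep hole sequence.  tau c a₀ k = (a_k , β_k) where τ_k = a_k + β_k √c i,
-- i.e. b_k = β_k · √c.  The recursion
--   a_k = 1/2,  b_k = (a_{k-1}² + b_{k-1}² - a_{k-1}) / (2 b_{k-1})
-- becomes β_k = (a² + β² c - a) / (2 β c).
tau : (c a₀ : ℚ) → ℕ → K
tau c a₀ zero = (a₀ , 1ℚ)
tau c a₀ (suc k) with tau c a₀ k
... | (a , β) = (½ , divℚ (a * a + β * β * c - a) ((+ 2 / 1) * β * c))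
  where open import Data.Integer using (+_)

aK : (c a₀ : ℚ) → ℕ → ℚ
aK c a₀ k = proj₁ (tau c a₀ k)

bSq : (c a₀ : ℚ) → ℕ → ℚ
bSq c a₀ k = proj₂ (tau c a₀ k) * proj₂ (tau c a₀ k) * c

absSq : (c a₀ : ℚ) → ℕ → ℚ
absSq c a₀ k = aK c a₀ k * aK c a₀ k + bSq c a₀ k

_∈Λ_ : K → K → Set
(p , q) ∈Λ (a , β) = ∃[ u ] ∃[ v ] (p ≡ ℤ→ℚ u + ℤ→ℚ v * a × q ≡ ℤ→ℚ v * β)

-- Isogeny C/Λ_τ → C/Λ_τ' of degree δ:  z ↦ γ z with γ ≠ 0, γΛ_τ ⊆ Λ_τ',
-- γ·1 = m₁₁ + m₂₁ τ',  γ·τ = m₁₂ + m₂₂ τ'  and δ = [Λ_τ' : γΛ_τ] = |det m|.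
-- (γ automatically lies in K since γ = γ·1 ∈ Λ_τ' ⊂ K.)
IsogenyOfDegree : (c : ℚ) → K → K → ℕ → Set
IsogenyOfDegree c τ τ' δ =
  Σ K λ γ → (γ ≢ (0ℚ , 0ℚ)) ×
   (∃[ m₁₁ ] ∃[ m₁₂ ] ∃[ m₂₁ ] ∃[ m₂₂ ]
     ( γ ≡ (ℤ→ℚ m₁₁ + ℤ→ℚ m₂₁ * proj₁ τ' , ℤ→ℚ m₂₁ * proj₂ τ')
     × mulK c γ τ ≡ (ℤ→ℚ m₁₂ + ℤ→ℚ m₂₂ * proj₁ τ' , ℤ→ℚ m₂₂ * proj₂ τ')
     × δ ≡ ℤ.∣ m₁₁ ℤ.* m₂₂ ℤ.- m₁₂ ℤ.* m₂₁ ∣))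

Isogenous : (c : ℚ) → K → K → Set
Isogenous c τ τ' = ∃[ δ ] IsogenyOfDegree c τ τ' δ

IsInt : ℚ → Set
IsInt x = ∃[ z ] x ≡ ℤ→ℚ z

ℕ→ℚ : ℕ → ℚ
ℕ→ℚ n = ℤ.+ n / 1

GoodD : (c a₀ : ℚ) → ℕ → ℕ → Set
GoodD c a₀ k d = IsInt (ℕ→ℚ d * aK c a₀ k) × IsInt (ℕ→ℚ d * ℕ→ℚ d * bSq c a₀ k)

IsDk : (c a₀ : ℚ) → ℕ → ℕ → Set
IsDk c a₀ k d = (0 Data.Nat.< d) × GoodD c a₀ k d ×
                (∀ d' → 0 Data.Nat.< d' → GoodD c a₀ k d' → d Data.Nat.≤ d')

-- R_k = (b_{k+1}/b_k) · d⁴ · (a_k² + b_k²)²,  where b_{k+1}/b_k = β_{k+1}/β_k.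
-- The bound of the theorem is  δ ≤ 12√3 · R_k,  equivalently δ² ≤ 432 · R_k² (R_k ≥ 0).
boundR : (c a₀ : ℚ) → ℕ → ℕ → ℚ
boundR c a₀ k d =
  divℚ (proj₂ (tau c a₀ (suc k))) (proj₂ (tau c a₀ k))
    * (ℕ→ℚ d * ℕ→ℚ d * ℕ→ℚ d * ℕ→ℚ d) * (absSq c a₀ k * absSq c a₀ k)

-- All τ_k lie in the imaginary quadratic field K = ℚ(√−c), c = b₀².  If τ, τ' ∈ K have nonzero
-- imaginary parts, τ = r₁ + r₂τ' with r₁, r₂ ∈ ℚ, so a positive integer N maps Λ_τ into Λ_τ'
-- and the curves are isogenous.  For one deep-hole step τ = a + bi ↦ τ' = ½ + b'i, where
-- 2bb' = |τ|² − a, multiplication by γ = 2d²b·i sends 1 ↦ −2dA + 2d²τ and τ' ↦ −(A² + D) + d²τ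
-- with the integers A = da, D = d²b².  Its degree is 2d⁴(|τ|² − a) = 4d⁴bb', and the bound
-- δ ≤ 12√3 (b'/b) d⁴|τ|⁴ reduces to b⁴ ≤ 27|τ|⁸, true because b² ≤ |τ|² and |τ| ≥ 1.
module Submission where

open import Defs
open import Data.Nat using (ℕ; suc; _<_; _≤_)
open import Data.Rational using (ℚ; 0ℚ; 1ℚ; ½; _*_; _+_) renaming (_<_ to _<ℚ_; _≤_ to _≤ℚ_)
open import Data.Integer using (+_)
open import Data.Product using (_×_; ∃-syntax)
open import Data.Sum using (_⊎_)

open import Data.Nat as ℕ using (zero; s≤s; z≤n)
import Data.Nat.Properties as ℕ
open import Data.Integer as ℤ using (-[1+_])
import Data.Integer.Properties as ℤ
open import Data.Rational
  using (_-_; -_; ↥_; ↧_; mkℚ; toℚᵘ; 1/_; ≢-nonZero; positive; nonNegative; nonPositive)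
open import Data.Rational.Properties
  using ( _≟_; _≤?_; module ≤-Reasoning
        ; toℚᵘ-injective; toℚᵘ-fromℚᵘ; toℚᵘ-homo-*; toℚᵘ-homo-+; toℚᵘ-homo‿-
        ; *-assoc; *-identityˡ; *-identityʳ; *-inverseˡ; *-zeroˡ; +-identityˡ; +-identityʳ
        ; ≤-refl; ≤-trans; ≤-total; <⇒≤; <-irrefl; <-≤-trans; +-mono-≤; neg-antimono-≤
        ; *-monoˡ-≤-nonNeg; *-monoʳ-≤-nonNeg; *-cancelʳ-<-nonNeg
        ; positive⁻¹; nonNegative⁻¹; pos*pos⇒pos; pos⇒nonNeg; nonNeg*nonNeg⇒nonNeg
        ; nonPos*nonPos⇒nonPos; normalize-pos )
import Data.Rational.Unnormalised as ℚᵘ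
import Data.Rational.Unnormalised.Properties as ℚᵘ
open import Data.Product using (_,_; proj₁; proj₂)
open import Data.Sum using (inj₁; inj₂)
open import Function using (_∘_)
open import Relation.Nullary using (yes; no; contradiction)
open import Relation.Nullary.Decidable using (from-yes)
open import Relation.Binary.PropositionalEquality
open import Data.Rational.Solver using (module +-*-Solver)
open +-*-Solver using (solve; _:=_; con; _:+_; _:*_; _:-_; :-_)

toℚᵘ-ℤ→ℚ : ∀ z → toℚᵘ (ℤ→ℚ z) ℚᵘ.≃ ℚᵘ.mkℚᵘ z 0
toℚᵘ-ℤ→ℚ z = toℚᵘ-fromℚᵘ (ℚᵘ.mkℚᵘ z 0)

ℤ→ℚ-homo-* : ∀ z w → ℤ→ℚ (z ℤ.* w) ≡ ℤ→ℚ z * ℤ→ℚ w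
ℤ→ℚ-homo-* z w = toℚᵘ-injective (begin
  toℚᵘ (ℤ→ℚ (z ℤ.* w))               ≈⟨ toℚᵘ-ℤ→ℚ (z ℤ.* w) ⟩
  ℚᵘ.mkℚᵘ z 0 ℚᵘ.* ℚᵘ.mkℚᵘ w 0       ≈⟨ ℚᵘ.*-cong (toℚᵘ-ℤ→ℚ z) (toℚᵘ-ℤ→ℚ w) ⟨
  toℚᵘ (ℤ→ℚ z) ℚᵘ.* toℚᵘ (ℤ→ℚ w)     ≈⟨ toℚᵘ-homo-* (ℤ→ℚ z) (ℤ→ℚ w) ⟨
  toℚᵘ (ℤ→ℚ z * ℤ→ℚ w)               ∎)
  where open ℚᵘ.≃-Reasoning

ℤ→ℚ-homo-+ : ∀ z w → ℤ→ℚ (z ℤ.+ w) ≡ ℤ→ℚ z + ℤ→ℚ w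
ℤ→ℚ-homo-+ z w = toℚᵘ-injective (begin
  toℚᵘ (ℤ→ℚ (z ℤ.+ w))               ≈⟨ toℚᵘ-ℤ→ℚ (z ℤ.+ w) ⟩
  ℚᵘ.mkℚᵘ (z ℤ.+ w) 0                ≈⟨ ℚᵘ.≃-reflexive (cong (λ n → ℚᵘ.mkℚᵘ n 0) drop-*1) ⟨
  ℚᵘ.mkℚᵘ z 0 ℚᵘ.+ ℚᵘ.mkℚᵘ w 0       ≈⟨ ℚᵘ.+-cong (toℚᵘ-ℤ→ℚ z) (toℚᵘ-ℤ→ℚ w) ⟨
  toℚᵘ (ℤ→ℚ z) ℚᵘ.+ toℚᵘ (ℤ→ℚ w)     ≈⟨ toℚᵘ-homo-+ (ℤ→ℚ z) (ℤ→ℚ w) ⟨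
  toℚᵘ (ℤ→ℚ z + ℤ→ℚ w)               ∎)
  where
  open ℚᵘ.≃-Reasoning
  drop-*1 : z ℤ.* + 1 ℤ.+ w ℤ.* + 1 ≡ z ℤ.+ w
  drop-*1 = cong₂ ℤ._+_ (ℤ.*-identityʳ z) (ℤ.*-identityʳ w)

ℤ→ℚ-homo‿- : ∀ z → ℤ→ℚ (ℤ.- z) ≡ - ℤ→ℚ z
ℤ→ℚ-homo‿- z = toℚᵘ-injective (begin
  toℚᵘ (ℤ→ℚ (ℤ.- z))   ≈⟨ toℚᵘ-ℤ→ℚ (ℤ.- z) ⟩
  ℚᵘ.- ℚᵘ.mkℚᵘ z 0     ≈⟨ ℚᵘ.-‿cong (toℚᵘ-ℤ→ℚ z) ⟨
  ℚᵘ.- toℚᵘ (ℤ→ℚ z)    ≈⟨ toℚᵘ-homo‿- (ℤ→ℚ z) ⟨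
  toℚᵘ (- ℤ→ℚ z)       ∎)
  where open ℚᵘ.≃-Reasoning

ℤ→ℚ-homo-- : ∀ z w → ℤ→ℚ (z ℤ.- w) ≡ ℤ→ℚ z - ℤ→ℚ w
ℤ→ℚ-homo-- z w = trans (ℤ→ℚ-homo-+ z (ℤ.- w)) (cong (λ y → ℤ→ℚ z + y) (ℤ→ℚ-homo‿- w))

↧p*p≡↥p : ∀ p → ℤ→ℚ (↧ p) * p ≡ ℤ→ℚ (↥ p)
↧p*p≡↥p p@(mkℚ n d-1 _) = toℚᵘ-injective (begin
  toℚᵘ (ℤ→ℚ (↧ p) * p)           ≈⟨ toℚᵘ-homo-* (ℤ→ℚ (↧ p)) p ⟩
  toℚᵘ (ℤ→ℚ (↧ p)) ℚᵘ.* toℚᵘ p   ≈⟨ ℚᵘ.*-congʳ (toℚᵘ-ℤ→ℚ (↧ p)) ⟩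
  ℚᵘ.mkℚᵘ (↧ p) 0 ℚᵘ.* toℚᵘ p    ≈⟨ ℚᵘ.*≡* cross ⟩
  ℚᵘ.mkℚᵘ n 0                     ≈⟨ toℚᵘ-ℤ→ℚ n ⟨
  toℚᵘ (ℤ→ℚ n)                    ∎)
  where
  open ℚᵘ.≃-Reasoning
  cross : (+ suc d-1 ℤ.* n) ℤ.* + 1 ≡ n ℤ.* + suc (d-1 ℕ.+ 0)
  cross = trans (ℤ.*-identityʳ _)
    (trans (ℤ.*-comm (+ suc d-1) n) (cong (λ m → n ℤ.* + suc m) (sym (ℕ.+-identityʳ d-1))))

0<ℤ→ℚ↧p : ∀ p → 0ℚ <ℚ ℤ→ℚ (↧ p)
0<ℤ→ℚ↧p (mkℚ _ d-1 _) = positive⁻¹ _ {{normalize-pos (suc d-1) 1}}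

∣z∣*∣z∣≡z*z : ∀ z → ℕ→ℚ ℤ.∣ z ∣ * ℕ→ℚ ℤ.∣ z ∣ ≡ ℤ→ℚ z * ℤ→ℚ z
∣z∣*∣z∣≡z*z (+ n)    = refl
∣z∣*∣z∣≡z*z -[1+ n ] = neg*neg (ℕ→ℚ (suc n))
  where
  neg*neg : ∀ p → p * p ≡ - p * - p
  neg*neg = solve 1 (λ p → p :* p := :- p :* :- p) refl

divℚ-*-cancel : ∀ p q → q ≢ 0ℚ → divℚ p q * q ≡ p
divℚ-*-cancel p q q≢0 with q ≟ 0ℚ
... | yes q≡0 = contradiction q≡0 q≢0
... | no q≢0′ = begin
  p * 1/ q * q    ≡⟨ *-assoc p (1/ q) q ⟩
  p * (1/ q * q)  ≡⟨ cong (p *_) (*-inverseˡ q) ⟩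
  p * 1ℚ          ≡⟨ *-identityʳ p ⟩
  p               ∎
  where
  open ≡-Reasoning
  instance _ = ≢-nonZero q≢0′

>0⇒≢0 : ∀ {p} → 0ℚ <ℚ p → p ≢ 0ℚ
>0⇒≢0 0<p p≡0 = <-irrefl (sym p≡0) 0<p

*-pres-0< : ∀ {p q} → 0ℚ <ℚ p → 0ℚ <ℚ q → 0ℚ <ℚ p * q
*-pres-0< {p} {q} 0<p 0<q = positive⁻¹ (p * q) {{pos*pos⇒pos p {{positive 0<p}} q {{positive 0<q}}}}

divℚ-pres-0< : ∀ {p q} → 0ℚ <ℚ p → 0ℚ <ℚ q → 0ℚ <ℚ divℚ p q
divℚ-pres-0< {p} {q} 0<p 0<q = *-cancelʳ-<-nonNeg q {{pos⇒nonNeg q {{positive 0<q}}}}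
  (subst₂ _<ℚ_ (sym (*-zeroˡ q)) (sym (divℚ-*-cancel p q (>0⇒≢0 0<q))) 0<p)

0≤p*p : ∀ p → 0ℚ ≤ℚ p * p
0≤p*p p with ≤-total 0ℚ p
... | inj₁ 0≤p = nonNegative⁻¹ (p * p) {{nonNeg*nonNeg⇒nonNeg p {{nonNegative 0≤p}} p {{nonNegative 0≤p}}}}
... | inj₂ p≤0 = nonNegative⁻¹ (p * p) {{nonPos*nonPos⇒nonPos p {{nonPositive p≤0}} p {{nonPositive p≤0}}}}

0<p-q : ∀ {p q} → 1ℚ ≤ℚ p → q ≤ℚ ½ → 0ℚ <ℚ p - q
0<p-q 1≤p q≤½ = <-≤-trans (positive⁻¹ ½) (+-mono-≤ 1≤p (neg-antimono-≤ q≤½))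

two : ℚ
two = ℤ→ℚ (+ 2)

mulK-scalar : ∀ c x a β → mulK c (x , 0ℚ) (a , β) ≡ (x * a , x * β)
mulK-scalar c x a β = cong₂ _,_ (real x a β c) (imaginary x a β)
  where
  real : ∀ x a β c → x * a - c * (0ℚ * β) ≡ x * a
  real = solve 4 (λ x a β c → x :* a :- c :* (con 0ℚ :* β) := x :* a) refl
  imaginary : ∀ x a β → x * β + 0ℚ * a ≡ x * β
  imaginary = solve 3 (λ x a β → x :* β :+ con 0ℚ :* a := x :* β) refl

isogenous-by-integer : ∀ c τ τ′ N u m → ℤ→ℚ N ≢ 0ℚ →
  ℤ→ℚ N * proj₁ τ ≡ ℤ→ℚ u + ℤ→ℚ m * proj₁ τ′ → ℤ→ℚ N * proj₂ τ ≡ ℤ→ℚ m * proj₂ τ′ →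
  Isogenous c τ τ′
isogenous-by-integer c (a , β) (a′ , β′) N u m N≢0 re im =
  _ , (ℤ→ℚ N , 0ℚ) , N≢0 ∘ cong proj₁ , N , u , + 0 , m , N∈Λ , trans (mulK-scalar c (ℤ→ℚ N) a β) (cong₂ _,_ re im) , refl
  where
  N∈Λ : (ℤ→ℚ N , 0ℚ) ≡ (ℤ→ℚ N + 0ℚ * a′ , 0ℚ * β′)
  N∈Λ = sym (cong₂ _,_ (trans (cong (λ x → ℤ→ℚ N + x) (*-zeroˡ a′)) (+-identityʳ (ℤ→ℚ N))) (*-zeroˡ β′))

-- With r = β/β′ and s = ↧r·a − ↥r·a′, the integer N = ↧r·↧s gives Nτ = ↥s + (↧s·↥r)τ′.
isogenous : ∀ c τ τ′ → proj₂ τ′ ≢ 0ℚ → Isogenous c τ τ′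
isogenous c (a , β) (a′ , β′) β′≢0 = isogenous-by-integer c (a , β) (a′ , β′) N (↥ s) m N≢0 re im
  where
  r = divℚ β β′
  s = ℤ→ℚ (↧ r) * a - ℤ→ℚ (↥ r) * a′
  N = ↧ r ℤ.* ↧ s
  m = ↧ s ℤ.* ↥ r
  open ≡-Reasoning
  N≢0 : ℤ→ℚ N ≢ 0ℚ
  N≢0 = >0⇒≢0 (subst (0ℚ <ℚ_) (sym (ℤ→ℚ-homo-* (↧ r) (↧ s))) (*-pres-0< (0<ℤ→ℚ↧p r) (0<ℤ→ℚ↧p s)))
  re : ℤ→ℚ N * a ≡ ℤ→ℚ (↥ s) + ℤ→ℚ m * a′
  re = begin
    ℤ→ℚ N * a                                    ≡⟨ cong (_* a) (ℤ→ℚ-homo-* (↧ r) (↧ s)) ⟩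
    ℤ→ℚ (↧ r) * ℤ→ℚ (↧ s) * a                    ≡⟨ regroup (ℤ→ℚ (↧ r)) (ℤ→ℚ (↧ s)) (ℤ→ℚ (↥ r)) a a′ ⟩
    ℤ→ℚ (↧ s) * s + ℤ→ℚ (↧ s) * ℤ→ℚ (↥ r) * a′  ≡⟨ cong₂ _+_ (↧p*p≡↥p s) (cong (_* a′) (sym (ℤ→ℚ-homo-* (↧ s) (↥ r)))) ⟩
    ℤ→ℚ (↥ s) + ℤ→ℚ m * a′                      ∎
    where
    regroup : ∀ R S v a a′ → R * S * a ≡ S * (R * a - v * a′) + S * v * a′
    regroup = solve 5 (λ R S v a a′ → R :* S :* a := S :* (R :* a :- v :* a′) :+ S :* v :* a′) refl
  im : ℤ→ℚ N * β ≡ ℤ→ℚ m * β′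
  im = begin
    ℤ→ℚ N * β                               ≡⟨ cong (_* β) (ℤ→ℚ-homo-* (↧ r) (↧ s)) ⟩
    ℤ→ℚ (↧ r) * ℤ→ℚ (↧ s) * β               ≡⟨ cong (ℤ→ℚ (↧ r) * ℤ→ℚ (↧ s) *_) (divℚ-*-cancel β β′ β′≢0) ⟨
    ℤ→ℚ (↧ r) * ℤ→ℚ (↧ s) * (r * β′)        ≡⟨ regroup (ℤ→ℚ (↧ r)) (ℤ→ℚ (↧ s)) r β′ ⟩
    ℤ→ℚ (↧ s) * (ℤ→ℚ (↧ r) * r) * β′        ≡⟨ cong (λ x → ℤ→ℚ (↧ s) * x * β′) (↧p*p≡↥p r) ⟩
    ℤ→ℚ (↧ s) * ℤ→ℚ (↥ r) * β′              ≡⟨ cong (_* β′) (ℤ→ℚ-homo-* (↧ s) (↥ r)) ⟨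
    ℤ→ℚ m * β′                              ∎
    where
    regroup : ∀ R S r β′ → R * S * (r * β′) ≡ S * (R * r) * β′
    regroup = solve 4 (λ R S r β′ → R :* S :* (r :* β′) := S :* (R :* r) :* β′) refl

deepHoleDegree : (c a β : ℚ) → ℕ → ℚ
deepHoleDegree c a β d = two * (ℕ→ℚ d * ℕ→ℚ d * ℕ→ℚ d * ℕ→ℚ d) * (a * a + β * β * c - a)

-- γ = 2x²(τ − a) = 2x²β·√c i, and the deep-hole relation is 2ββ′c = |τ|² − a.
deepHole-mulK : ∀ c a β β′ x → β′ * (two * β * c) ≡ a * a + β * β * c - a →
  mulK c (- (two * x * (x * a)) + two * x * x * a , two * x * x * β) (½ , β′)
    ≡ (- ((x * a) * (x * a) + x * x * (β * β * c)) + x * x * a , x * x * β)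
deepHole-mulK c a β β′ x hole = cong₂ _,_ real (imaginary x a β β′)
  where
  open ≡-Reasoning
  collect : ∀ x a β β′ c →
    (- (two * x * (x * a)) + two * x * x * a) * ½ - c * (two * x * x * β * β′) ≡ - (x * x) * (β′ * (two * β * c))
  collect = solve 5 (λ x a β β′ c →
    (:- (con two :* x :* (x :* a)) :+ con two :* x :* x :* a) :* con ½ :- c :* (con two :* x :* x :* β :* β′)
      := :- (x :* x) :* (β′ :* (con two :* β :* c))) refl
  expand : ∀ x a B → - (x * x) * (a * a + B - a) ≡ - ((x * a) * (x * a) + x * x * B) + x * x * a
  expand = solve 3 (λ x a B → :- (x :* x) :* (a :* a :+ B :- a) := :- ((x :* a) :* (x :* a) :+ x :* x :* B) :+ x :* x :* a) refl
  imaginary : ∀ x a β β′ → (- (two * x * (x * a)) + two * x * x * a) * β′ + two * x * x * β * ½ ≡ x * x * β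
  imaginary = solve 4 (λ x a β β′ →
    (:- (con two :* x :* (x :* a)) :+ con two :* x :* x :* a) :* β′ :+ con two :* x :* x :* β :* con ½ := x :* x :* β) refl
  real : (- (two * x * (x * a)) + two * x * x * a) * ½ - c * (two * x * x * β * β′)
       ≡ - ((x * a) * (x * a) + x * x * (β * β * c)) + x * x * a
  real = begin
    (- (two * x * (x * a)) + two * x * x * a) * ½ - c * (two * x * x * β * β′)  ≡⟨ collect x a β β′ c ⟩
    - (x * x) * (β′ * (two * β * c))                                            ≡⟨ cong (- (x * x) *_) hole ⟩
    - (x * x) * (a * a + β * β * c - a)                                         ≡⟨ expand x a (β * β * c) ⟩
    - ((x * a) * (x * a) + x * x * (β * β * c)) + x * x * a                     ∎

deepHole-det : ∀ x a B →
  - (two * x * (x * a)) * (x * x) - - ((x * a) * (x * a) + x * x * B) * (two * x * x)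
    ≡ two * (x * x * x * x) * (a * a + B - a)
deepHole-det = solve 3 (λ x a B →
  :- (con two :* x :* (x :* a)) :* (x :* x) :- :- ((x :* a) :* (x :* a) :+ x :* x :* B) :* (con two :* x :* x)
    := con two :* (x :* x :* x :* x) :* (a :* a :+ B :- a)) refl

deepHole-isogeny : ∀ c a β β′ d .{{_ : ℕ.NonZero d}} → 0ℚ <ℚ β →
  β′ * (two * β * c) ≡ a * a + β * β * c - a →
  IsInt (ℕ→ℚ d * a) → IsInt (ℕ→ℚ d * ℕ→ℚ d * (β * β * c)) →
  ∃[ δ ] IsogenyOfDegree c (½ , β′) (a , β) δ
       × ℕ→ℚ δ * ℕ→ℚ δ ≡ deepHoleDegree c a β d * deepHoleDegree c a β d
deepHole-isogeny c a β β′ d 0<β hole (A , dA) (D , dD) =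
  ℤ.∣ det ∣ , (γ , γ≢0 , m₁₁ , m₁₂ , m₂₁ , m₂₂ , refl , γτ′ , refl) , degree²
  where
  x = ℕ→ℚ d
  m₁₁ = ℤ.- (+ 2 ℤ.* + d ℤ.* A)
  m₂₁ = + 2 ℤ.* + d ℤ.* + d
  m₁₂ = ℤ.- (A ℤ.* A ℤ.+ D)
  m₂₂ = + d ℤ.* + d
  det = m₁₁ ℤ.* m₂₂ ℤ.- m₁₂ ℤ.* m₂₁
  γ : K
  γ = (ℤ→ℚ m₁₁ + ℤ→ℚ m₂₁ * a , ℤ→ℚ m₂₁ * β)
  ι-m₁₁ : ℤ→ℚ m₁₁ ≡ - (two * x * (x * a))
  ι-m₁₁ = trans (ℤ→ℚ-homo‿- (+ 2 ℤ.* + d ℤ.* A))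
    (cong -_ (trans (ℤ→ℚ-homo-* (+ 2 ℤ.* + d) A) (cong₂ _*_ (ℤ→ℚ-homo-* (+ 2) (+ d)) (sym dA))))
  ι-m₂₁ : ℤ→ℚ m₂₁ ≡ two * x * x
  ι-m₂₁ = trans (ℤ→ℚ-homo-* (+ 2 ℤ.* + d) (+ d)) (cong (_* x) (ℤ→ℚ-homo-* (+ 2) (+ d)))
  ι-m₁₂ : ℤ→ℚ m₁₂ ≡ - ((x * a) * (x * a) + x * x * (β * β * c))
  ι-m₁₂ = trans (ℤ→ℚ-homo‿- (A ℤ.* A ℤ.+ D))
    (cong -_ (trans (ℤ→ℚ-homo-+ (A ℤ.* A) D) (cong₂ _+_ (trans (ℤ→ℚ-homo-* A A) (cong₂ _*_ (sym dA) (sym dA))) (sym dD))))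
  ι-m₂₂ : ℤ→ℚ m₂₂ ≡ x * x
  ι-m₂₂ = ℤ→ℚ-homo-* (+ d) (+ d)
  γ≢0 : γ ≢ (0ℚ , 0ℚ)
  γ≢0 = >0⇒≢0 (subst (λ y → 0ℚ <ℚ y * β) (sym ι-m₂₁) (*-pres-0< (*-pres-0< (*-pres-0< 0<two 0<x) 0<x) 0<β)) ∘ cong proj₂
    where
    0<two : 0ℚ <ℚ two
    0<two = positive⁻¹ two
    0<x : 0ℚ <ℚ x
    0<x = positive⁻¹ x {{normalize-pos d 1}}
  γτ′ : mulK c γ (½ , β′) ≡ (ℤ→ℚ m₁₂ + ℤ→ℚ m₂₂ * a , ℤ→ℚ m₂₂ * β)
  γτ′ = subst₂ (λ (i₁₁ , i₂₁) (i₁₂ , i₂₂) → mulK c (i₁₁ + i₂₁ * a , i₂₁ * β) (½ , β′) ≡ (i₁₂ + i₂₂ * a , i₂₂ * β))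
    (sym (cong₂ _,_ ι-m₁₁ ι-m₂₁)) (sym (cong₂ _,_ ι-m₁₂ ι-m₂₂)) (deepHole-mulK c a β β′ x hole)
  degree² : ℕ→ℚ ℤ.∣ det ∣ * ℕ→ℚ ℤ.∣ det ∣ ≡ deepHoleDegree c a β d * deepHoleDegree c a β d
  degree² = trans (∣z∣*∣z∣≡z*z det) (cong (λ y → y * y) ι-det)
    where
    ι-det : ℤ→ℚ det ≡ deepHoleDegree c a β d
    ι-det = begin
      ℤ→ℚ det ≡⟨ trans (ℤ→ℚ-homo-- (m₁₁ ℤ.* m₂₂) (m₁₂ ℤ.* m₂₁)) (cong₂ _-_ (ℤ→ℚ-homo-* m₁₁ m₂₂) (ℤ→ℚ-homo-* m₁₂ m₂₁)) ⟩
      ℤ→ℚ m₁₁ * ℤ→ℚ m₂₂ - ℤ→ℚ m₁₂ * ℤ→ℚ m₂₁ ≡⟨ cong₂ _-_ (cong₂ _*_ ι-m₁₁ ι-m₂₂) (cong₂ _*_ ι-m₁₂ ι-m₂₁) ⟩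
      - (two * x * (x * a)) * (x * x) - - ((x * a) * (x * a) + x * x * (β * β * c)) * (two * x * x) ≡⟨ deepHole-det x a (β * β * c) ⟩
      deepHoleDegree c a β d ∎
      where open ≡-Reasoning

p*p≤27q⁴ : ∀ {p q} → 0ℚ ≤ℚ p → p ≤ℚ q → 1ℚ ≤ℚ q → p * p ≤ℚ ℤ→ℚ (+ 27) * (q * q * (q * q))
p*p≤27q⁴ {p} {q} 0≤p p≤q 1≤q = begin
  p * p                        ≤⟨ *-monoʳ-≤-nonNeg p {{nonNegative 0≤p}} p≤q ⟩
  q * p                        ≤⟨ *-monoˡ-≤-nonNeg q {{nonNegative 0≤q}} p≤q ⟩
  q * q                        ≡⟨ *-identityˡ (q * q) ⟨
  1ℚ * (q * q)                 ≤⟨ *-monoʳ-≤-nonNeg (q * q) {{nonNegative (0≤p*p q)}} 1≤q*q ⟩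
  q * q * (q * q)              ≡⟨ *-identityˡ (q * q * (q * q)) ⟨
  1ℚ * (q * q * (q * q))       ≤⟨ *-monoʳ-≤-nonNeg (q * q * (q * q)) {{nonNegative (0≤p*p (q * q))}} 1≤27 ⟩
  ℤ→ℚ (+ 27) * (q * q * (q * q)) ∎
  where
  open ≤-Reasoning
  0≤q : 0ℚ ≤ℚ q
  0≤q = ≤-trans (from-yes (0ℚ ≤? 1ℚ)) 1≤q
  1≤q*q : 1ℚ ≤ℚ q * q
  1≤q*q = ≤-trans 1≤q (subst (_≤ℚ q * q) (*-identityʳ q) (*-monoˡ-≤-nonNeg q {{nonNegative 0≤q}} 1≤q))
  1≤27 : 1ℚ ≤ℚ ℤ→ℚ (+ 27)
  1≤27 = from-yes (1ℚ ≤? ℤ→ℚ (+ 27))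

-- 432 = 16 · 27, so this is 16t² times the previous inequality.
degree-bound : ∀ t {p q} → 0ℚ ≤ℚ p → p ≤ℚ q → 1ℚ ≤ℚ q →
  (two * two * t * p) * (two * two * t * p) ≤ℚ ℤ→ℚ (+ 432) * ((t * (q * q)) * (t * (q * q)))
degree-bound t {p} {q} 0≤p p≤q 1≤q = begin
  (two * two * t * p) * (two * two * t * p)           ≡⟨ split t p ⟩
  ℤ→ℚ (+ 16) * (t * t) * (p * p)                      ≤⟨ *-monoˡ-≤-nonNeg (ℤ→ℚ (+ 16) * (t * t)) {{16t²-nonNeg}} (p*p≤27q⁴ 0≤p p≤q 1≤q) ⟩
  ℤ→ℚ (+ 16) * (t * t) * (ℤ→ℚ (+ 27) * (q * q * (q * q))) ≡⟨ merge t q ⟩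
  ℤ→ℚ (+ 432) * ((t * (q * q)) * (t * (q * q)))       ∎
  where
  open ≤-Reasoning
  split : ∀ t p → (two * two * t * p) * (two * two * t * p) ≡ ℤ→ℚ (+ 16) * (t * t) * (p * p)
  split = solve 2 (λ t p → (con two :* con two :* t :* p) :* (con two :* con two :* t :* p) := con (ℤ→ℚ (+ 16)) :* (t :* t) :* (p :* p)) refl
  merge : ∀ t q → ℤ→ℚ (+ 16) * (t * t) * (ℤ→ℚ (+ 27) * (q * q * (q * q))) ≡ ℤ→ℚ (+ 432) * ((t * (q * q)) * (t * (q * q)))
  merge = solve 2 (λ t q → con (ℤ→ℚ (+ 16)) :* (t :* t) :* (con (ℤ→ℚ (+ 27)) :* (q :* q :* (q :* q)))
                          := con (ℤ→ℚ (+ 432)) :* ((t :* (q :* q)) :* (t :* (q :* q)))) refl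
  16t²-nonNeg = nonNeg*nonNeg⇒nonNeg (ℤ→ℚ (+ 16)) (t * t) {{nonNegative (0≤p*p t)}}

deepHoleDegree-bound : ∀ c a β β′ d → 0ℚ <ℚ c → 0ℚ <ℚ β → 1ℚ ≤ℚ a * a + β * β * c →
  β′ * (two * β * c) ≡ a * a + β * β * c - a →
  let R = divℚ β′ β * (ℕ→ℚ d * ℕ→ℚ d * ℕ→ℚ d * ℕ→ℚ d) * ((a * a + β * β * c) * (a * a + β * β * c)) in
  deepHoleDegree c a β d * deepHoleDegree c a β d ≤ℚ ℕ→ℚ 432 * (R * R)
deepHoleDegree-bound c a β β′ d 0<c 0<β 1≤S hole = begin
  deepHoleDegree c a β d * deepHoleDegree c a β d ≡⟨ cong (λ y → y * y) degree≡ ⟩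
  (two * two * t * B) * (two * two * t * B)       ≤⟨ degree-bound t 0≤B B≤S 1≤S ⟩
  ℤ→ℚ (+ 432) * ((t * (S * S)) * (t * (S * S)))   ∎
  where
  open ≤-Reasoning
  d⁴ = ℕ→ℚ d * ℕ→ℚ d * ℕ→ℚ d * ℕ→ℚ d
  ρ = divℚ β′ β
  t = ρ * d⁴
  B = β * β * c
  S = a * a + B
  0≤B : 0ℚ ≤ℚ B
  0≤B = <⇒≤ (*-pres-0< (*-pres-0< 0<β 0<β) 0<c)
  B≤S : B ≤ℚ S
  B≤S = subst (_≤ℚ S) (+-identityˡ B) (+-mono-≤ (0≤p*p a) (≤-refl {B}))
  degree≡ : deepHoleDegree c a β d ≡ two * two * t * B
  degree≡ = E.begin
    two * d⁴ * (S - a)                    E.≡⟨ cong (two * d⁴ *_) hole ⟨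
    two * d⁴ * (β′ * (two * β * c))       E.≡⟨ cong (λ y → two * d⁴ * (y * (two * β * c))) ρβ ⟨
    two * d⁴ * (ρ * β * (two * β * c))    E.≡⟨ regroup two d⁴ ρ β c ⟩
    two * two * t * B                     E.∎
    where
    module E = ≡-Reasoning
    ρβ : ρ * β ≡ β′
    ρβ = divℚ-*-cancel β′ β (>0⇒≢0 0<β)
    regroup : ∀ w y r b c → w * y * (r * b * (w * b * c)) ≡ w * w * (r * y) * (b * b * c)
    regroup = solve 5 (λ w y r b c → w :* y :* (r :* b :* (w :* b :* c)) := w :* w :* (r :* y) :* (b :* b :* c)) refl

module DeepHoleSequence (c a₀ : ℚ) (0<c : 0ℚ <ℚ c) (a₀≤½ : a₀ ≤ℚ ½) (1≤∣τ₀∣² : 1ℚ ≤ℚ a₀ * a₀ + c)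
  (n : ℕ) (1<∣τₘ∣² : ∀ m → 1 ≤ m → m < n → 1ℚ <ℚ absSq c a₀ m) where

  a : ℕ → ℚ
  a = aK c a₀

  β : ℕ → ℚ
  β k = proj₂ (tau c a₀ k)

  a≤½ : ∀ k → a k ≤ℚ ½
  a≤½ zero    = a₀≤½
  a≤½ (suc k) = ≤-refl

  1≤∣τ∣² : ∀ k → k < n → 1ℚ ≤ℚ absSq c a₀ k
  1≤∣τ∣² zero    _   = subst (λ y → 1ℚ ≤ℚ a₀ * a₀ + y) (sym (*-identityˡ c)) 1≤∣τ₀∣²
  1≤∣τ∣² (suc k) k<n = <⇒≤ (1<∣τₘ∣² (suc k) (s≤s z≤n) k<n)

  0<β : ∀ k → k ≤ n → 0ℚ <ℚ β k
  0<2βc : ∀ k → k < n → 0ℚ <ℚ two * β k * c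
  0<β zero    _   = positive⁻¹ 1ℚ
  0<β (suc k) k<n = divℚ-pres-0< (0<p-q (1≤∣τ∣² k k<n) (a≤½ k)) (0<2βc k k<n)
  0<2βc k k<n = *-pres-0< (*-pres-0< (positive⁻¹ two) (0<β k (ℕ.<⇒≤ k<n))) 0<c

  deepHole-relation : ∀ k → k < n → β (suc k) * (two * β k * c) ≡ absSq c a₀ k - a k
  deepHole-relation k k<n = divℚ-*-cancel (absSq c a₀ k - a k) (two * β k * c) (>0⇒≢0 (0<2βc k k<n))

  τ-isogenous : ∀ i j → j ≤ n → Isogenous c (tau c a₀ i) (tau c a₀ j)
  τ-isogenous i j j≤n = isogenous c (tau c a₀ i) (tau c a₀ j) (>0⇒≢0 (0<β j j≤n))

  τ-step-isogeny : ∀ k d → suc k ≤ n → IsDk c a₀ k d →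
    ∃[ δ ] ((IsogenyOfDegree c (tau c a₀ k) (tau c a₀ (suc k)) δ
             ⊎ IsogenyOfDegree c (tau c a₀ (suc k)) (tau c a₀ k) δ)
           × ℕ→ℚ δ * ℕ→ℚ δ ≤ℚ ℕ→ℚ 432 * (boundR c a₀ k d * boundR c a₀ k d))
  τ-step-isogeny k d k<n (0<d , (dA , dD²b²) , _) =
    let δ , iso , δ² = deepHole-isogeny c (a k) (β k) (β (suc k)) d {{ℕ.>-nonZero 0<d}} 0<βₖ (deepHole-relation k k<n) dA dD²b²
    in δ , inj₂ iso , subst (_≤ℚ ℕ→ℚ 432 * (boundR c a₀ k d * boundR c a₀ k d)) (sym δ²)
                        (deepHoleDegree-bound c (a k) (β k) (β (suc k)) d 0<c 0<βₖ (1≤∣τ∣² k k<n) (deepHole-relation k k<n))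
    where
    0<βₖ : 0ℚ <ℚ β k
    0<βₖ = 0<β k (ℕ.<⇒≤ k<n)

theorem1p3 : (a₀ c : ℚ) → 0ℚ <ℚ c → 0ℚ ≤ℚ a₀ → a₀ ≤ℚ ½ → 1ℚ ≤ℚ a₀ * a₀ + c →
    (n : ℕ) → 1 ≤ n → absSq c a₀ n ≤ℚ 1ℚ →
    (∀ m → 1 ≤ m → m < n → 1ℚ <ℚ absSq c a₀ m) →
    ((i j : ℕ) → i ≤ n → j ≤ n → Isogenous c (tau c a₀ i) (tau c a₀ j))
    × ((k d : ℕ) → suc k ≤ n → IsDk c a₀ k d →
        ∃[ δ ] ((IsogenyOfDegree c (tau c a₀ k) (tau c a₀ (suc k)) δ
                 ⊎ IsogenyOfDegree c (tau c a₀ (suc k)) (tau c a₀ k) δ)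
               × ℕ→ℚ δ * ℕ→ℚ δ ≤ℚ ℕ→ℚ 432 * (boundR c a₀ k d * boundR c a₀ k d)))
theorem1p3 a₀ c 0<c _ a₀≤½ 1≤∣τ₀∣² n _ _ 1<∣τₘ∣² = (λ i j _ j≤n → τ-isogenous i j j≤n) , τ-step-isogeny
  where open DeepHoleSequence c a₀ 0<c a₀≤½ 1≤∣τ₀∣² n 1<∣τₘ∣²
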